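{- Let $\mathbb{K}$ be a field of characteristic zero, $G$ a graph on $\{0,\dots,n\}$, and $f\in\mathbb{K}[x]$ a polynomial with non-vanishing linear term. Then $\mathcal{C}_G$ and $\mathcal{F}[f]_G$ coincide as subalgebras of $\Phi_G$.
   Context: Graphs are loopless, multiple edges allowed. $\Phi_G$ is the commutative $\mathbb{K}$-algebra generated by $\phi_e$ ($e$ an edge) with relations $\phi_e^2=0$. For a vertex $i$ and edge $e$: $c_{i,e}=1$ if $e$ joins $i$ to $j$ with $i<j$, $c_{i,e}=-1$ if $e$ joins $i$ to $j$ with $i>j$, $c_{i,e}=0$ otherwise. $X_i=\sum_e c_{i,e}\phi_e$. $\mathcal{C}_G$ is the subalgebra of $\Phi_G$ generated by $X_1,\dots,X_n$ (note $\sum_{i=0}^nX_i=0$). $\mathcal{F}[f]_G$ is the subalgebra of $\Phi_G$ generated by $1$ and $f(X_0),\dots,f(X_n)$. -}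

module Defs where

open import Level using (Level; _⊔_) renaming (suc to lsuc)
open import Algebra.Bundles using (CommutativeRing)
open import Data.Nat using (ℕ; zero; suc)
open import Data.Fin using (Fin; zero; suc; _<_)
import Data.Fin as Fin
open import Data.Fin.Subset using (Subset; ⁅_⁆)
open import Data.Bool using (Bool; true; false)
import Data.Bool as Bool
open import Data.Vec using (Vec; []; _∷_)
import Data.Vec.Properties as VecP
open import Data.List using (List; []; _∷_)
open import Data.Product using (Σ; _×_; _,_; proj₁; proj₂)
open import Relation.Nullary using (¬_; yes; no)
open import Relation.Binary.PropositionalEquality using (_≡_)
open import Relation.Nullary.Decidable using (⌊_⌋)

record Field (c ℓ : Level) : Set (lsuc (c ⊔ ℓ)) where
  field
    commutativeRing : CommutativeRing c ℓ
  open CommutativeRing commutativeRing public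
  field
    1≉0     : ¬ (1# ≈ 0#)
    inverse : ∀ x → ¬ (x ≈ 0#) → Σ Carrier (λ y → (x * y) ≈ 1#)

module FieldTheory {c ℓ} (K : Field c ℓ) where
  open Field K using (Carrier; _≈_; _+_; _*_; -_; 0#; 1#)

  natK : ℕ → Carrier
  natK zero    = 0#
  natK (suc k) = 1# + natK k

  CharacteristicZero : Set ℓ
  CharacteristicZero = ∀ (k : ℕ) → ¬ (natK (suc k) ≈ 0#)

  -- Polynomials in K[x] as coefficient lists a₀ ∷ a₁ ∷ a₂ ∷ …
  Poly : Set c
  Poly = List Carrier

  coeff : Poly → ℕ → Carrier
  coeff []       _       = 0#
  coeff (a ∷ p)  zero    = a
  coeff (a ∷ p)  (suc k) = coeff p k

  -- The algebra Φ_G for a graph with m edges:  K[φ_1,…,φ_m]/(φ_e²).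
  -- An element is given by its coefficients on the square-free monomials
  -- ∏_{e∈S} φ_e, indexed by subsets S ⊆ {edges} (Subset m = Vec Bool m).

  Φ : ℕ → Set c
  Φ m = Subset m → Carrier

  _≈Φ_ : ∀ {m} → Φ m → Φ m → Set ℓ
  a ≈Φ b = ∀ S → a S ≈ b S

  0Φ : ∀ {m} → Φ m
  0Φ _ = 0#

  1Φ : ∀ {m} → Φ m
  1Φ []          = 1#
  1Φ (true  ∷ S) = 0#
  1Φ (false ∷ S) = 1Φ S

  _+Φ_ : ∀ {m} → Φ m → Φ m → Φ m
  (a +Φ b) S = a S + b S

  _·Φ_ : ∀ {m} → Carrier → Φ m → Φ m
  (k ·Φ a) S = k * a S

  -- multiplication: writing a = a₀ + φ a₁ for the first variable φ,
  -- (a₀ + φ a₁)(b₀ + φ b₁) = a₀b₀ + φ (a₀b₁ + a₁b₀)   since φ² = 0.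
  _*Φ_ : ∀ {m} → Φ m → Φ m → Φ m
  _*Φ_ {zero}  a b []          = a [] * b []
  _*Φ_ {suc m} a b (false ∷ S) =
    _*Φ_ {m} (λ T → a (false ∷ T)) (λ T → b (false ∷ T)) S
  _*Φ_ {suc m} a b (true ∷ S)  =
    (_*Φ_ {m} (λ T → a (false ∷ T)) (λ T → b (true ∷ T)) S)
    + (_*Φ_ {m} (λ T → a (true ∷ T)) (λ T → b (false ∷ T)) S)

  φ : ∀ {m} → Fin m → Φ m
  φ e S with VecP.≡-dec Bool._≟_ S ⁅ e ⁆
  ... | yes _ = 1#
  ... | no  _ = 0#

  sumΦ : ∀ {m} k → (Fin k → Φ m) → Φ m
  sumΦ zero    g = 0Φ
  sumΦ (suc k) g = g zero +Φ sumΦ k (λ i → g (suc i))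

  evalΦ : ∀ {m} → Poly → Φ m → Φ m
  evalΦ []      x = 0Φ
  evalΦ (a ∷ p) x = (a ·Φ 1Φ) +Φ (x *Φ evalΦ p x)

  -- Graphs on the vertex set {0,…,n} with m edges (multiple edges allowed,
  -- no loops): edge e joins vertices  end₁ e  and  end₂ e, with end₁ e ≠ end₂ e.
  record Graph (n m : ℕ) : Set where
    field
      end₁ end₂ : Fin m → Fin (suc n)
      loopless  : ∀ e → ¬ (end₁ e ≡ end₂ e)

  cVal : ∀ {n} → Fin (suc n) → Fin (suc n) → Fin (suc n) → Carrier
  cVal i a b with i Fin.≟ a | i Fin.≟ b
  ... | yes _ | _     with a Fin.<? b
  ...   | yes _ = 1#
  ...   | no  _ = - 1#
  cVal i a b | no _ | yes _ with b Fin.<? a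
  ...   | yes _ = 1#
  ...   | no  _ = - 1#
  cVal i a b | no _ | no _ = 0#

  module _ {n m : ℕ} (G : Graph n m) where
    open Graph G

    coef : Fin (suc n) → Fin m → Carrier
    coef i e = cVal i (end₁ e) (end₂ e)

    X : Fin (suc n) → Φ m
    X i = sumΦ m (λ e → coef i e ·Φ φ e)

  data InSubalg {m : ℕ} {I : Set} (gen : I → Φ m) : Φ m → Set (c ⊔ ℓ) where
    one   : InSubalg gen 1Φ
    gen∈  : ∀ i → InSubalg gen (gen i)
    add   : ∀ {x y} → InSubalg gen x → InSubalg gen y → InSubalg gen (x +Φ y)
    scale : ∀ k {x} → InSubalg gen x → InSubalg gen (k ·Φ x)
    mul   : ∀ {x y} → InSubalg gen x → InSubalg gen y → InSubalg gen (x *Φ y)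
    resp  : ∀ {x y} → x ≈Φ y → InSubalg gen x → InSubalg gen y

  module _ {n m : ℕ} (G : Graph n m) where
    C-gen : Fin n → Φ m
    C-gen i = X G (suc i)

    F-gen : Poly → Fin (suc n) → Φ m
    F-gen f i = evalΦ f (X G i)

    SameSubalgebra : Poly → Set (c ⊔ ℓ)
    SameSubalgebra f = ∀ (x : Φ m) →
      (InSubalg C-gen x → InSubalg (F-gen f) x) × (InSubalg (F-gen f) x → InSubalg C-gen x)

-- X_0 = -(X_1 + ⋯ + X_n) because every edge contributes +1 at one end and -1 at the other,
-- so C_G contains every f(X_i). Conversely every X_i lies in the ideal 𝔪 generated by the φ_e,
-- and 𝔪^(m+1) = 0 for a graph with m edges. Writing a₁ for the linear coefficient of f and
-- u = a₁⁻¹, the Newton iteration Z ↦ Z + u (f(X) - f(Z)), started at 0, stays in the subalgebra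
-- generated by 1 and f(X), and each step gains one power of 𝔪 in the error Z - X, since
-- f(Z) - f(X) ≡ a₁ (Z - X) modulo 𝔪·(Z - X). After m + 1 steps it reaches X exactly.
module Submission where

open import Defs
open import Level using (Level)
open import Data.Nat using (ℕ; zero; suc)
open import Relation.Nullary using (¬_; Dec; yes; no)

import Data.Nat as ℕ
import Data.Nat.Properties as ℕ
open import Data.Fin using (Fin; zero; suc; _≟_; _<?_)
open import Data.Fin.Properties using (<-asym; <-cmp)
open import Data.Fin.Subset using (∣_∣; ⁅_⁆)
open import Data.Fin.Subset.Properties using (∣p∣≤n; ∣⁅x⁆∣≡1)
open import Data.Bool using (true; false)
import Data.Bool as Bool
open import Data.Vec using ([]; _∷_)
import Data.Vec.Properties as Vecₚ
open import Data.List using ([]; _∷_)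
open import Data.Product using (_×_; _,_; proj₁; proj₂)
open import Data.Empty using (⊥-elim)
open import Relation.Binary.Definitions using (tri<; tri≈; tri>)
import Relation.Binary.PropositionalEquality as ≡
open ≡ using (_≡_; _≢_)

module _ {c ℓ : Level} (K : Field c ℓ) where
  open Field K hiding (zero; _-_)
  open FieldTheory K
  open import Algebra.Properties.Ring ring
    using (-1*x≈-x; -‿distribˡ-*; -‿distribʳ-*; [y-z]x≈yx-zx; -‿involutive; -‿+-comm;
           +-inverseˡ-unique; x∙y⁻¹≈ε⇒x≈y; xyx⁻¹≈y; ⁻¹-anti-homo-//)
  open import Algebra.Properties.CommutativeSemigroup +-commutativeSemigroup
    using (interchange; xy∙z≈xz∙y)
  open import Algebra.Properties.CommutativeMonoid.Sum +-commutativeMonoid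
    using (sum; sum-cong-≋; ∑-comm; ∑-distrib-+; sum-replicate-zero)
  open import Algebra.Properties.Semiring.Sum semiring using (*-distribʳ-sum)
  open import Relation.Binary.Reasoning.Setoid setoid

  infixl 6 _-_
  _-_ : Carrier → Carrier → Carrier
  x - y = x + - y

  [x+y]-[x+z]≈y-z : ∀ x y z → (x + y) - (x + z) ≈ y - z
  [x+y]-[x+z]≈y-z x y z = begin
    (x + y) - (x + z)      ≈⟨ +-congˡ (-‿+-comm x z) ⟨
    (x + y) + (- x + - z)  ≈⟨ interchange x y (- x) (- z) ⟩
    (x - x) + (y - z)      ≈⟨ +-congʳ (-‿inverseʳ x) ⟩
    0# + (y - z)           ≈⟨ +-identityˡ (y - z) ⟩
    y - z                  ∎

  [x-y]+[y-z]≈x-z : ∀ x y z → (x - y) + (y - z) ≈ x - z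
  [x-y]+[y-z]≈x-z x y z = begin
    (x - y) + (y - z)    ≈⟨ +-assoc x (- y) (y - z) ⟩
    x + (- y + (y - z))  ≈⟨ +-congˡ (+-assoc (- y) y (- z)) ⟨
    x + ((- y + y) - z)  ≈⟨ +-congˡ (+-congʳ (-‿inverseˡ y)) ⟩
    x + (0# - z)         ≈⟨ +-congˡ (+-identityˡ (- z)) ⟩
    x - z                ∎

  part₀ part₁ : ∀ {m} → Φ (suc m) → Φ m
  part₀ a S = a (false ∷ S)
  part₁ a S = a (true ∷ S)

  _-Φ_ : ∀ {m} → Φ m → Φ m → Φ m
  (a -Φ b) S = a S - b S

  -Φ_ : ∀ {m} → Φ m → Φ m
  (-Φ a) S = - a S

  ≈Φ-sym : ∀ {m} {a b : Φ m} → a ≈Φ b → b ≈Φ a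
  ≈Φ-sym a≈b S = sym (a≈b S)

  *Φ-comm : ∀ {m} (a b : Φ m) → (a *Φ b) ≈Φ (b *Φ a)
  *Φ-comm {zero}  a b []          = *-comm (a []) (b [])
  *Φ-comm {suc m} a b (false ∷ S) = *Φ-comm (part₀ a) (part₀ b) S
  *Φ-comm {suc m} a b (true ∷ S)  =
    trans (+-cong (*Φ-comm (part₀ a) (part₁ b) S) (*Φ-comm (part₁ a) (part₀ b) S)) (+-comm _ _)

  *Φ-distribˡ-+Φ : ∀ {m} (a b d : Φ m) → (a *Φ (b +Φ d)) ≈Φ ((a *Φ b) +Φ (a *Φ d))
  *Φ-distribˡ-+Φ {zero}  a b d []          = distribˡ (a []) (b []) (d [])
  *Φ-distribˡ-+Φ {suc m} a b d (false ∷ S) = *Φ-distribˡ-+Φ (part₀ a) (part₀ b) (part₀ d) S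
  *Φ-distribˡ-+Φ {suc m} a b d (true ∷ S)  =
    trans (+-cong (*Φ-distribˡ-+Φ (part₀ a) (part₁ b) (part₁ d) S)
                  (*Φ-distribˡ-+Φ (part₁ a) (part₀ b) (part₀ d) S))
          (interchange _ _ _ _)

  *Φ-distribʳ--Φ : ∀ {m} (a b d : Φ m) → ((a -Φ b) *Φ d) ≈Φ ((a *Φ d) -Φ (b *Φ d))
  *Φ-distribʳ--Φ {zero}  a b d []          = [y-z]x≈yx-zx (d []) (a []) (b [])
  *Φ-distribʳ--Φ {suc m} a b d (false ∷ S) = *Φ-distribʳ--Φ (part₀ a) (part₀ b) (part₀ d) S
  *Φ-distribʳ--Φ {suc m} a b d (true ∷ S)  =
    trans (+-cong (*Φ-distribʳ--Φ (part₀ a) (part₀ b) (part₁ d) S)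
                  (*Φ-distribʳ--Φ (part₁ a) (part₁ b) (part₀ d) S))
          (trans (interchange _ _ _ _) (+-congˡ (-‿+-comm _ _)))

  *Φ-distribˡ--Φ : ∀ {m} (d a b : Φ m) → (d *Φ (a -Φ b)) ≈Φ ((d *Φ a) -Φ (d *Φ b))
  *Φ-distribˡ--Φ d a b S =
    trans (*Φ-comm d (a -Φ b) S)
          (trans (*Φ-distribʳ--Φ a b d S) (+-cong (*Φ-comm a d S) (-‿cong (*Φ-comm b d S))))

  *Φ-·Φ : ∀ {m} k (a b : Φ m) → (a *Φ (k ·Φ b)) ≈Φ (k ·Φ (a *Φ b))
  *Φ-·Φ {zero}  k a b []          =
    trans (sym (*-assoc (a []) k (b []))) (trans (*-congʳ (*-comm (a []) k)) (*-assoc k (a []) (b [])))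
  *Φ-·Φ {suc m} k a b (false ∷ S) = *Φ-·Φ k (part₀ a) (part₀ b) S
  *Φ-·Φ {suc m} k a b (true ∷ S)  =
    trans (+-cong (*Φ-·Φ k (part₀ a) (part₁ b) S) (*Φ-·Φ k (part₁ a) (part₀ b) S)) (sym (distribˡ k _ _))

  *Φ-zeroʳ : ∀ {m} (a : Φ m) → (a *Φ 0Φ) ≈Φ 0Φ
  *Φ-zeroʳ {zero}  a []          = zeroʳ (a [])
  *Φ-zeroʳ {suc m} a (false ∷ S) = *Φ-zeroʳ (part₀ a) S
  *Φ-zeroʳ {suc m} a (true ∷ S)  =
    trans (+-cong (*Φ-zeroʳ (part₀ a) S) (*Φ-zeroʳ (part₁ a) S)) (+-identityʳ 0#)

  *Φ-identityʳ : ∀ {m} (a : Φ m) → (a *Φ 1Φ) ≈Φ a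
  *Φ-identityʳ {zero}  a []          = *-identityʳ (a [])
  *Φ-identityʳ {suc m} a (false ∷ S) = *Φ-identityʳ (part₀ a) S
  *Φ-identityʳ {suc m} a (true ∷ S)  =
    trans (+-cong (*Φ-zeroʳ (part₀ a) S) (*Φ-identityʳ (part₁ a) S)) (+-identityˡ _)

  *Φ-difference : ∀ {m} (a a′ b b′ : Φ m) →
    ((a *Φ b) -Φ (a′ *Φ b′)) ≈Φ (((a -Φ a′) *Φ b) +Φ (a′ *Φ (b -Φ b′)))
  *Φ-difference a a′ b b′ S =
    sym (trans (+-cong (*Φ-distribʳ--Φ a a′ b S) (*Φ-distribˡ--Φ a′ b b′ S)) ([x-y]+[y-z]≈x-z _ _ _))

  -- a ∈𝔪^ k : a has no monomials of degree < k, i.e. a lies in the k-th power of the ideal 𝔪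
  -- generated by the φ_e.
  infix 4 _∈𝔪^_
  _∈𝔪^_ : ∀ {m} → Φ m → ℕ → Set ℓ
  a ∈𝔪^ k = ∀ S → ∣ S ∣ ℕ.< k → a S ≈ 0#

  ∈𝔪^0 : ∀ {m} (a : Φ m) → a ∈𝔪^ 0
  ∈𝔪^0 a S ()

  ∈𝔪^-resp : ∀ {m k} {a b : Φ m} → a ≈Φ b → a ∈𝔪^ k → b ∈𝔪^ k
  ∈𝔪^-resp a≈b a∈ S p = trans (sym (a≈b S)) (a∈ S p)

  ∈𝔪^-weaken : ∀ {m j k} {a : Φ m} → j ℕ.≤ k → a ∈𝔪^ k → a ∈𝔪^ j
  ∈𝔪^-weaken j≤k a∈ S p = a∈ S (ℕ.<-≤-trans p j≤k)

  ∈𝔪^-from-difference : ∀ {m k} {a b : Φ m} → (a -Φ b) ∈𝔪^ k → b ∈𝔪^ k → a ∈𝔪^ k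
  ∈𝔪^-from-difference a-b∈ b∈ S p = trans (x∙y⁻¹≈ε⇒x≈y _ _ (a-b∈ S p)) (b∈ S p)

  ∈𝔪^suc⇒≈0Φ : ∀ {m} {a : Φ m} → a ∈𝔪^ suc m → a ≈Φ 0Φ
  ∈𝔪^suc⇒≈0Φ a∈ S = a∈ S (ℕ.s≤s (∣p∣≤n S))

  0Φ-∈𝔪^ : ∀ {m k} → 0Φ {m} ∈𝔪^ k
  0Φ-∈𝔪^ S p = refl

  +Φ-∈𝔪^ : ∀ {m k} {a b : Φ m} → a ∈𝔪^ k → b ∈𝔪^ k → (a +Φ b) ∈𝔪^ k
  +Φ-∈𝔪^ a∈ b∈ S p = trans (+-cong (a∈ S p) (b∈ S p)) (+-identityʳ 0#)

  ·Φ-∈𝔪^ : ∀ {m k} r {a : Φ m} → a ∈𝔪^ k → (r ·Φ a) ∈𝔪^ k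
  ·Φ-∈𝔪^ r a∈ S p = trans (*-congˡ (a∈ S p)) (zeroʳ r)

  sumΦ-∈𝔪^ : ∀ {m k} n {g : Fin n → Φ m} → (∀ i → g i ∈𝔪^ k) → sumΦ n g ∈𝔪^ k
  sumΦ-∈𝔪^ zero    g∈ = 0Φ-∈𝔪^
  sumΦ-∈𝔪^ (suc n) g∈ = +Φ-∈𝔪^ (g∈ zero) (sumΦ-∈𝔪^ n (λ i → g∈ (suc i)))

  part₀-∈𝔪^ : ∀ {m k} {a : Φ (suc m)} → a ∈𝔪^ k → part₀ a ∈𝔪^ k
  part₀-∈𝔪^ a∈ S = a∈ (false ∷ S)

  part₁-∈𝔪^ : ∀ {m} k {a : Φ (suc m)} → a ∈𝔪^ k → part₁ a ∈𝔪^ ℕ.pred k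
  part₁-∈𝔪^ zero    a∈ S ()
  part₁-∈𝔪^ (suc k) a∈ S p = a∈ (true ∷ S) (ℕ.s≤s p)

  *Φ-∈𝔪^ : ∀ {m} i j {a b : Φ m} → a ∈𝔪^ i → b ∈𝔪^ j → (a *Φ b) ∈𝔪^ (i ℕ.+ j)
  *Φ-∈𝔪^ {zero}  zero    j a∈ b∈ [] p = trans (*-congˡ (b∈ [] p)) (zeroʳ _)
  *Φ-∈𝔪^ {zero}  (suc i) j a∈ b∈ [] p = trans (*-congʳ (a∈ [] (ℕ.s≤s ℕ.z≤n))) (zeroˡ _)
  *Φ-∈𝔪^ {suc m} i j a∈ b∈ (false ∷ S) p = *Φ-∈𝔪^ i j (part₀-∈𝔪^ a∈) (part₀-∈𝔪^ b∈) S p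
  *Φ-∈𝔪^ {suc m} i j a∈ b∈ (true ∷ S) p =
    trans (+-cong (*Φ-∈𝔪^ i (ℕ.pred j) (part₀-∈𝔪^ a∈) (part₁-∈𝔪^ j b∈) S (<-+-predʳ i j p))
                  (*Φ-∈𝔪^ (ℕ.pred i) j (part₁-∈𝔪^ i a∈) (part₀-∈𝔪^ b∈) S (<-+-predˡ i j p)))
          (+-identityʳ 0#)
    where
      <-+-predʳ : ∀ {s} i j → suc s ℕ.< i ℕ.+ j → s ℕ.< i ℕ.+ ℕ.pred j
      <-+-predʳ i zero    q = ℕ.<-trans (ℕ.n<1+n _) q
      <-+-predʳ {s} i (suc j) q = ℕ.≤-pred (≡.subst (suc (suc s) ℕ.≤_) (ℕ.+-suc i j) q)

      <-+-predˡ : ∀ {s} i j → suc s ℕ.< i ℕ.+ j → s ℕ.< ℕ.pred i ℕ.+ j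
      <-+-predˡ zero    j q = ℕ.<-trans (ℕ.n<1+n _) q
      <-+-predˡ (suc i) j q = ℕ.≤-pred q

  evalΦ-∷-difference : ∀ {m} a q (Z X : Φ m) →
    (evalΦ (a ∷ q) Z -Φ evalΦ (a ∷ q) X)
      ≈Φ (((Z -Φ X) *Φ evalΦ q Z) +Φ (X *Φ (evalΦ q Z -Φ evalΦ q X)))
  evalΦ-∷-difference a q Z X S =
    trans ([x+y]-[x+z]≈y-z _ _ _) (*Φ-difference Z X (evalΦ q Z) (evalΦ q X) S)

  evalΦ-cong-𝔪^ : ∀ {m k} f {Z X : Φ m} → X ∈𝔪^ 1 → (Z -Φ X) ∈𝔪^ k →
    (evalΦ f Z -Φ evalΦ f X) ∈𝔪^ k
  evalΦ-cong-𝔪^ []                  X∈ Z-X∈ S p = -‿inverseʳ 0#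
  evalΦ-cong-𝔪^ {k = k} (a ∷ q) {Z} {X} X∈ Z-X∈ =
    ∈𝔪^-resp (≈Φ-sym (evalΦ-∷-difference a q Z X))
      (+Φ-∈𝔪^ (∈𝔪^-resp (*Φ-comm (evalΦ q Z) (Z -Φ X)) (*Φ-∈𝔪^ 0 k (∈𝔪^0 _) Z-X∈))
              (∈𝔪^-weaken (ℕ.n≤1+n k) (*Φ-∈𝔪^ 1 k X∈ (evalΦ-cong-𝔪^ q X∈ Z-X∈))))

  evalΦ-linear-𝔪^ : ∀ {m k} f {Z X : Φ m} → Z ∈𝔪^ 1 → X ∈𝔪^ 1 → (Z -Φ X) ∈𝔪^ k →
    ((evalΦ f Z -Φ evalΦ f X) -Φ (coeff f 1 ·Φ (Z -Φ X))) ∈𝔪^ suc k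
  evalΦ-linear-𝔪^ [] _ _ _ S _ = trans (+-cong (-‿inverseʳ 0#) (-‿cong (zeroˡ _))) (-‿inverseʳ 0#)
  evalΦ-linear-𝔪^ (a ∷ []) {Z} {X} Z∈ X∈ Z-X∈ S p =
    trans (+-congʳ (trans ([x+y]-[x+z]≈y-z _ _ _) (+-cong (*Φ-zeroʳ Z S) (-‿cong (*Φ-zeroʳ X S)))))
          (evalΦ-linear-𝔪^ [] Z∈ X∈ Z-X∈ S p)
  evalΦ-linear-𝔪^ {k = k} (a ∷ b ∷ r) {Z} {X} Z∈ X∈ Z-X∈ =
    ∈𝔪^-resp (≈Φ-sym decomposition)
      (+Φ-∈𝔪^ (∈𝔪^-resp (*Φ-comm _ (Z -Φ X)) (*Φ-∈𝔪^ 1 k (*Φ-∈𝔪^ 1 0 Z∈ (∈𝔪^0 _)) Z-X∈))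
              (*Φ-∈𝔪^ 1 k X∈ (evalΦ-cong-𝔪^ (b ∷ r) X∈ Z-X∈)))
    where
      q = b ∷ r
      D = Z -Φ X

      D*q : (D *Φ evalΦ q Z) ≈Φ ((b ·Φ D) +Φ (D *Φ (Z *Φ evalΦ r Z)))
      D*q S = trans (*Φ-distribˡ-+Φ D (b ·Φ 1Φ) (Z *Φ evalΦ r Z) S)
                    (+-congʳ (trans (*Φ-·Φ b D 1Φ S) (*-congˡ (*Φ-identityʳ D S))))

      decomposition : ((evalΦ (a ∷ q) Z -Φ evalΦ (a ∷ q) X) -Φ (b ·Φ D))
                        ≈Φ ((D *Φ (Z *Φ evalΦ r Z)) +Φ (X *Φ (evalΦ q Z -Φ evalΦ q X)))
      decomposition S = begin
        (evalΦ (a ∷ q) Z S - evalΦ (a ∷ q) X S) - b * D S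
          ≈⟨ +-congʳ (evalΦ-∷-difference a q Z X S) ⟩
        ((D *Φ evalΦ q Z) S + (X *Φ (evalΦ q Z -Φ evalΦ q X)) S) - b * D S
          ≈⟨ +-congʳ (+-congʳ (D*q S)) ⟩
        ((b * D S + (D *Φ (Z *Φ evalΦ r Z)) S) + (X *Φ (evalΦ q Z -Φ evalΦ q X)) S) - b * D S
          ≈⟨ +-congʳ (+-assoc _ _ _) ⟩
        (b * D S + ((D *Φ (Z *Φ evalΦ r Z)) S + (X *Φ (evalΦ q Z -Φ evalΦ q X)) S)) - b * D S
          ≈⟨ xyx⁻¹≈y (b * D S) _ ⟩
        (D *Φ (Z *Φ evalΦ r Z)) S + (X *Φ (evalΦ q Z -Φ evalΦ q X)) S
          ∎

  module _ {m} {J : Set} {gen : J → Φ m} where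
    0Φ-∈ : InSubalg gen 0Φ
    0Φ-∈ = resp (λ S → zeroˡ (1Φ S)) (scale 0# one)

    -Φ‿∈ : ∀ {a} → InSubalg gen a → InSubalg gen (-Φ a)
    -Φ‿∈ {a} a∈ = resp (λ S → -1*x≈-x (a S)) (scale (- 1#) a∈)

    -Φ-∈ : ∀ {a b} → InSubalg gen a → InSubalg gen b → InSubalg gen (a -Φ b)
    -Φ-∈ a∈ b∈ = add a∈ (-Φ‿∈ b∈)

    evalΦ-∈ : ∀ f {a} → InSubalg gen a → InSubalg gen (evalΦ f a)
    evalΦ-∈ []      a∈ = 0Φ-∈
    evalΦ-∈ (r ∷ f) a∈ = add (scale r one) (mul a∈ (evalΦ-∈ f a∈))

    sumΦ-∈ : ∀ n {g : Fin n → Φ m} → (∀ i → InSubalg gen (g i)) → InSubalg gen (sumΦ n g)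
    sumΦ-∈ zero    g∈ = 0Φ-∈
    sumΦ-∈ (suc n) g∈ = add (g∈ zero) (sumΦ-∈ n (λ i → g∈ (suc i)))

  InSubalg-⊆ : ∀ {m} {J J′ : Set} {gen : J → Φ m} {gen′ : J′ → Φ m} →
    (∀ j → InSubalg gen′ (gen j)) → ∀ {a} → InSubalg gen a → InSubalg gen′ a
  InSubalg-⊆ gen⊆ one           = one
  InSubalg-⊆ gen⊆ (gen∈ j)      = gen⊆ j
  InSubalg-⊆ gen⊆ (add a∈ b∈)   = add (InSubalg-⊆ gen⊆ a∈) (InSubalg-⊆ gen⊆ b∈)
  InSubalg-⊆ gen⊆ (scale r a∈)  = scale r (InSubalg-⊆ gen⊆ a∈)
  InSubalg-⊆ gen⊆ (mul a∈ b∈)   = mul (InSubalg-⊆ gen⊆ a∈) (InSubalg-⊆ gen⊆ b∈)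
  InSubalg-⊆ gen⊆ (resp a≈b a∈) = resp a≈b (InSubalg-⊆ gen⊆ a∈)

  newton-error : ∀ {a u} → a * u ≈ 1# → ∀ z x y w →
    (z + u * (y - w)) - x ≈ (- u) * ((w - y) - a * (z - x))
  newton-error {a} {u} au≈1 z x y w = begin
    (z + u * (y - w)) - x              ≈⟨ xy∙z≈xz∙y z _ (- x) ⟩
    d + u * (y - w)                    ≈⟨ +-congʳ d≈u[ad] ⟩
    u * (a * d) + u * (y - w)          ≈⟨ distribˡ u _ _ ⟨
    u * (a * d + (y - w))              ≈⟨ *-congˡ (+-congˡ (⁻¹-anti-homo-// w y)) ⟨
    u * (a * d - (w - y))              ≈⟨ *-congˡ (⁻¹-anti-homo-// (w - y) (a * d)) ⟨
    u * - ((w - y) - a * d)            ≈⟨ -‿distribʳ-* u _ ⟨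
    - (u * ((w - y) - a * d))          ≈⟨ -‿distribˡ-* u _ ⟩
    (- u) * ((w - y) - a * d)          ∎
    where
      d = z - x
      d≈u[ad] : d ≈ u * (a * d)
      d≈u[ad] = begin
        d            ≈⟨ *-identityˡ d ⟨
        1# * d       ≈⟨ *-congʳ au≈1 ⟨
        (a * u) * d  ≈⟨ *-congʳ (*-comm a u) ⟩
        (u * a) * d  ≈⟨ *-assoc u a d ⟩
        u * (a * d)  ∎

  module Newton {m} (f : Poly) (X : Φ m) (X∈𝔪 : X ∈𝔪^ 1)
                (u : Carrier) (a₁u≈1 : coeff f 1 * u ≈ 1#) where
    step : Φ m → Φ m
    step Z = Z +Φ (u ·Φ (evalΦ f X -Φ evalΦ f Z))

    approx : ℕ → Φ m
    approx zero    = 0Φ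
    approx (suc k) = step (approx k)

    step-error : ∀ {k Z} → Z ∈𝔪^ 1 → (Z -Φ X) ∈𝔪^ k → (step Z -Φ X) ∈𝔪^ suc k
    step-error {Z = Z} Z∈ Z-X∈ =
      ∈𝔪^-resp (λ S → sym (newton-error a₁u≈1 (Z S) (X S) (evalΦ f X S) (evalΦ f Z S)))
        (·Φ-∈𝔪^ (- u) (evalΦ-linear-𝔪^ f Z∈ X∈𝔪 Z-X∈))

    approx-∈𝔪^ : ∀ k → approx k ∈𝔪^ 1 × (approx k -Φ X) ∈𝔪^ k
    approx-∈𝔪^ zero    = 0Φ-∈𝔪^ , ∈𝔪^0 _
    approx-∈𝔪^ (suc k) =
      ∈𝔪^-from-difference (∈𝔪^-weaken (ℕ.s≤s ℕ.z≤n) error∈) X∈𝔪 , error∈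
      where
        error∈ = step-error (proj₁ (approx-∈𝔪^ k)) (proj₂ (approx-∈𝔪^ k))

    approx-reaches-X : approx (suc m) ≈Φ X
    approx-reaches-X S = x∙y⁻¹≈ε⇒x≈y _ _ (∈𝔪^suc⇒≈0Φ (proj₂ (approx-∈𝔪^ (suc m))) S)

    approx-∈ : ∀ {J : Set} {gen : J → Φ m} → InSubalg gen (evalΦ f X) → ∀ k → InSubalg gen (approx k)
    approx-∈ fX∈ zero    = 0Φ-∈
    approx-∈ fX∈ (suc k) = add (approx-∈ fX∈ k) (scale u (-Φ-∈ fX∈ (evalΦ-∈ f (approx-∈ fX∈ k))))

  φ-∈𝔪^1 : ∀ {m} (e : Fin m) → φ e ∈𝔪^ 1
  φ-∈𝔪^1 e S p with Vecₚ.≡-dec Bool._≟_ S ⁅ e ⁆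
  ... | yes ≡.refl = ⊥-elim (ℕ.<-irrefl (∣⁅x⁆∣≡1 e) p)
  ... | no _       = refl

  X-∈𝔪^1 : ∀ {n m} (G : Graph n m) i → X G i ∈𝔪^ 1
  X-∈𝔪^1 {m = m} G i = sumΦ-∈𝔪^ m (λ e → ·Φ-∈𝔪^ (coef G i e) (φ-∈𝔪^1 e))

  δ : ∀ {n} → Fin n → Fin n → Carrier
  δ zero    zero    = 1#
  δ zero    (suc _) = 0#
  δ (suc _) zero    = 0#
  δ (suc i) (suc j) = δ i j

  δ-≡ : ∀ {n} {i j : Fin n} → i ≡ j → δ i j ≈ 1#
  δ-≡ {i = zero}  ≡.refl = refl
  δ-≡ {i = suc i} ≡.refl = δ-≡ {i = i} ≡.refl

  δ-≢ : ∀ {n} {i j : Fin n} → i ≢ j → δ i j ≈ 0#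
  δ-≢ {i = zero}  {zero}  i≢j = ⊥-elim (i≢j ≡.refl)
  δ-≢ {i = zero}  {suc j} i≢j = refl
  δ-≢ {i = suc i} {zero}  i≢j = refl
  δ-≢ {i = suc i} {suc j} i≢j = δ-≢ (λ i≡j → i≢j (≡.cong suc i≡j))

  ∑-δ : ∀ {n} (j : Fin n) → sum (λ i → δ i j) ≈ 1#
  ∑-δ {suc n} zero    = trans (+-congˡ (sum-replicate-zero n)) (+-identityʳ 1#)
  ∑-δ {suc n} (suc j) = trans (+-identityˡ _) (∑-δ j)

  sgn : ∀ {n} → Fin n → Fin n → Carrier
  sgn a b with a <? b
  ... | yes _ = 1#
  ... | no  _ = - 1#

  cVal-source : ∀ {n} {i a b : Fin (suc n)} → i ≡ a → cVal i a b ≈ sgn a b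
  cVal-source {i = i} {b = b} ≡.refl with i ≟ i
  ... | no i≢i = ⊥-elim (i≢i ≡.refl)
  ... | yes _ with i <? b
  ...   | yes _ = refl
  ...   | no  _ = refl

  cVal-target : ∀ {n} {i a b : Fin (suc n)} → i ≡ b → a ≢ b → cVal i a b ≈ - sgn a b
  cVal-target {i = i} {a} ≡.refl a≢i with i ≟ a | i ≟ i
  ... | yes i≡a | _      = ⊥-elim (a≢i (≡.sym i≡a))
  ... | no _    | no i≢i = ⊥-elim (i≢i ≡.refl)
  ... | no _    | yes _ with i <? a | a <? i | <-cmp a i
  ...   | yes i<a | yes a<i | _            = ⊥-elim (<-asym a<i i<a)
  ...   | yes _   | no _    | _            = sym (-‿involutive 1#)
  ...   | no _    | yes _   | _            = refl
  ...   | no _    | no a≮i  | tri< a<i _ _ = ⊥-elim (a≮i a<i)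
  ...   | no _    | no _    | tri≈ _ a≡i _ = ⊥-elim (a≢i a≡i)
  ...   | no i≮a  | no _    | tri> _ _ i<a = ⊥-elim (i≮a i<a)

  cVal-elsewhere : ∀ {n} {i a b : Fin (suc n)} → i ≢ a → i ≢ b → cVal i a b ≈ 0#
  cVal-elsewhere {i = i} {a} {b} i≢a i≢b with i ≟ a | i ≟ b
  ... | yes i≡a | _       = ⊥-elim (i≢a i≡a)
  ... | no _    | yes i≡b = ⊥-elim (i≢b i≡b)
  ... | no _    | no _    = refl

  cVal-δ : ∀ {n} {a b : Fin (suc n)} → a ≢ b → ∀ i →
    cVal i a b ≈ δ i a * sgn a b + δ i b * - sgn a b
  cVal-δ {a = a} {b} a≢b i = expand (i ≟ a) (i ≟ b)
    where
      s = sgn a b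

      expand : Dec (i ≡ a) → Dec (i ≡ b) → cVal i a b ≈ δ i a * s + δ i b * - s
      expand (yes i≡a) _ = begin
        cVal i a b               ≈⟨ cVal-source i≡a ⟩
        s                        ≈⟨ +-identityʳ s ⟨
        s + 0#                   ≈⟨ +-cong (*-identityˡ s) (zeroˡ (- s)) ⟨
        1# * s + 0# * - s        ≈⟨ +-cong (*-congʳ (δ-≡ i≡a)) (*-congʳ (δ-≢ i≢b)) ⟨
        δ i a * s + δ i b * - s  ∎
        where i≢b = λ i≡b → a≢b (≡.trans (≡.sym i≡a) i≡b)
      expand (no i≢a) (yes i≡b) = begin
        cVal i a b               ≈⟨ cVal-target i≡b a≢b ⟩
        - s                      ≈⟨ +-identityˡ (- s) ⟨
        0# + - s                 ≈⟨ +-cong (zeroˡ s) (*-identityˡ (- s)) ⟨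
        0# * s + 1# * - s        ≈⟨ +-cong (*-congʳ (δ-≢ i≢a)) (*-congʳ (δ-≡ i≡b)) ⟨
        δ i a * s + δ i b * - s  ∎
      expand (no i≢a) (no i≢b) = begin
        cVal i a b               ≈⟨ cVal-elsewhere i≢a i≢b ⟩
        0#                       ≈⟨ +-identityʳ 0# ⟨
        0# + 0#                  ≈⟨ +-cong (zeroˡ s) (zeroˡ (- s)) ⟨
        0# * s + 0# * - s        ≈⟨ +-cong (*-congʳ (δ-≢ i≢a)) (*-congʳ (δ-≢ i≢b)) ⟨
        δ i a * s + δ i b * - s  ∎

  ∑-cVal≈0 : ∀ {n} {a b : Fin (suc n)} → a ≢ b → sum (λ i → cVal i a b) ≈ 0#
  ∑-cVal≈0 {a = a} {b} a≢b = begin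
    sum (λ i → cVal i a b)
      ≈⟨ sum-cong-≋ (cVal-δ a≢b) ⟩
    sum (λ i → δ i a * s + δ i b * - s)
      ≈⟨ ∑-distrib-+ (λ i → δ i a * s) (λ i → δ i b * - s) ⟩
    sum (λ i → δ i a * s) + sum (λ i → δ i b * - s)
      ≈⟨ +-cong (*-distribʳ-sum s (λ i → δ i a)) (*-distribʳ-sum (- s) (λ i → δ i b)) ⟨
    sum (λ i → δ i a) * s + sum (λ i → δ i b) * - s
      ≈⟨ +-cong (*-congʳ (∑-δ a)) (*-congʳ (∑-δ b)) ⟩
    1# * s + 1# * - s
      ≈⟨ +-cong (*-identityˡ s) (*-identityˡ (- s)) ⟩
    s - s
      ≈⟨ -‿inverseʳ s ⟩
    0# ∎
    where s = sgn a b

  sumΦ-apply : ∀ {m} n (g : Fin n → Φ m) S → sumΦ n g S ≡ sum (λ i → g i S)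
  sumΦ-apply zero    g S = ≡.refl
  sumΦ-apply (suc n) g S = ≡.cong (g zero S +_) (sumΦ-apply n (λ i → g (suc i)) S)

  ∑-X≈0Φ : ∀ {n m} (G : Graph n m) → sumΦ (suc n) (X G) ≈Φ 0Φ
  ∑-X≈0Φ {n} {m} G S = begin
    sumΦ (suc n) (X G) S
      ≡⟨ sumΦ-apply (suc n) (X G) S ⟩
    sum (λ i → X G i S)
      ≈⟨ sum-cong-≋ (λ i → reflexive (sumΦ-apply m (λ e → coef G i e ·Φ φ e) S)) ⟩
    sum (λ i → sum (λ e → coef G i e * φ e S))
      ≈⟨ ∑-comm (λ i e → coef G i e * φ e S) ⟩
    sum (λ e → sum (λ i → coef G i e * φ e S))
      ≈⟨ sum-cong-≋ (λ e → *-distribʳ-sum (φ e S) (λ i → coef G i e)) ⟨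
    sum (λ e → sum (λ i → coef G i e) * φ e S)
      ≈⟨ sum-cong-≋ (λ e → trans (*-congʳ (∑-cVal≈0 (loopless e))) (zeroˡ _)) ⟩
    sum {m} (λ e → 0#)
      ≈⟨ sum-replicate-zero m ⟩
    0# ∎
    where open Graph G

  X-∈-C : ∀ {n m} (G : Graph n m) i → InSubalg (C-gen G) (X G i)
  X-∈-C {n} G zero    = resp X₀≈ (-Φ‿∈ (sumΦ-∈ n gen∈))
    where
      X₀≈ : (-Φ sumΦ n (C-gen G)) ≈Φ X G zero
      X₀≈ S = sym (+-inverseˡ-unique _ _ (∑-X≈0Φ G S))
  X-∈-C G (suc j) = gen∈ j

  C-gen-∈-F : ∀ {n m} (G : Graph n m) f → ¬ (coeff f 1 ≈ 0#) → ∀ j → InSubalg (F-gen G f) (C-gen G j)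
  C-gen-∈-F {m = m} G f a₁≉0 j = resp approx-reaches-X (approx-∈ (gen∈ (suc j)) (suc m))
    where
      open Newton f (X G (suc j)) (X-∈𝔪^1 G (suc j))
                  (proj₁ (inverse _ a₁≉0)) (proj₂ (inverse _ a₁≉0))

proposition2 : ∀ {c ℓ : Level} (K : Field c ℓ) → FieldTheory.CharacteristicZero K →
    ∀ (n m : ℕ) (G : FieldTheory.Graph K n m) (f : FieldTheory.Poly K) →
    ¬ (Field._≈_ K (FieldTheory.coeff K f 1) (Field.0# K)) →
    FieldTheory.SameSubalgebra K G f
proposition2 K _ n m G f a₁≉0 _ =
  InSubalg-⊆ K (C-gen-∈-F K G f a₁≉0) , InSubalg-⊆ K (λ i → evalΦ-∈ K f (X-∈-C K G i))
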